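{- Let $t$ be a square-free integer with $t\equiv 1 \pmod 8$ and let $K=\mathbb{Q}(\sqrt{t})$ with ring of integers $\mathcal{O}_K$. Let $a,b\in\mathcal{O}_K\setminus\{0\}$ and $c=2^d b-3^r$, where $r,d$ are positive integers with $d\geq 2$ and $r$ odd. Then the equation $ax^d-y^2-z^2+xyz-c=0$ has no solution $(x_0,y_0,z_0)\in\mathcal{O}_K^3$ with $x_0\in 2\mathcal{O}_K$. -}

module Defs where

open import Data.Nat as ℕ using (ℕ; zero; suc)
open import Data.Integer as ℤ using (ℤ; +_; _/ℕ_)
open import Data.Integer.Divisibility using () renaming (_∣_ to _∣ℤ_)
open import Relation.Binary.PropositionalEquality using (_≡_)

SquareFree : ℤ → Set
SquareFree t = ∀ (n : ℤ) → (n ℤ.* n) ∣ℤ t → ℤ.∣ n ∣ ≡ 1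

-- Ring of integers of K = ℚ(√t) for squarefree t ≡ 1 (mod 4), t ≠ 1:
-- 𝒪_K = ℤ[ω], ω = (1 + √t)/2, ω² = ω + (t-1)/4.
-- An element  m ⊕ n  represents  m + n·ω.
infix 4 _⊕_
record 𝒪 : Set where
  constructor _⊕_
  field
    re : ℤ
    im : ℤ

module _ (t : ℤ) where
  κ : ℤ
  κ = (t ℤ.- ℤ.1ℤ) /ℕ 4

  ι : ℤ → 𝒪
  ι m = m ⊕ ℤ.0ℤ

  0𝒪 : 𝒪
  0𝒪 = ι ℤ.0ℤ

  _+𝒪_ : 𝒪 → 𝒪 → 𝒪
  (a ⊕ b) +𝒪 (c ⊕ d) = (a ℤ.+ c) ⊕ (b ℤ.+ d)

  -𝒪_ : 𝒪 → 𝒪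
  -𝒪 (a ⊕ b) = (ℤ.- a) ⊕ (ℤ.- b)

  _-𝒪_ : 𝒪 → 𝒪 → 𝒪
  x -𝒪 y = x +𝒪 (-𝒪 y)

  -- (a + bω)(c + dω) = ac + bdκ + (ad + bc + bd)ω
  _*𝒪_ : 𝒪 → 𝒪 → 𝒪
  (a ⊕ b) *𝒪 (c ⊕ d) =
    (a ℤ.* c ℤ.+ b ℤ.* d ℤ.* κ) ⊕ (a ℤ.* d ℤ.+ b ℤ.* c ℤ.+ b ℤ.* d)

  _^𝒪_ : 𝒪 → ℕ → 𝒪
  x ^𝒪 zero = ι ℤ.1ℤ
  x ^𝒪 suc n = x *𝒪 (x ^𝒪 n)

{-# OPTIONS --safe #-}
-- Reduce modulo 4.  As t ≡ 1 (mod 8), κ = (t − 1)/4 is even, hence κ² ≡ 2κ (mod 4) and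
-- ω ↦ κ is a ring homomorphism 𝒪_K → ℤ/4.  It sends x = 2w to 2W, so for d ≥ 2 it kills
-- a x^d and 2^d b, while 3^r ↦ 3 for odd r: the equation becomes
-- 3 − Y² − Z² + 2WYZ ≡ 0 (mod 4), which fails for every residue triple.
module Submission where

open import Defs
open import Data.Nat as ℕ using (ℕ; _≥_)
open import Data.Nat.Divisibility using () renaming (_∣_ to _∣ℕ_)
open import Data.Integer as ℤ using (ℤ; +_)
open import Data.Integer.Divisibility using () renaming (_∣_ to _∣ℤ_)
open import Data.Product using (Σ; _×_)
open import Relation.Nullary using (¬_)
open import Relation.Binary.PropositionalEquality using (_≡_; _≢_)

open import Data.Empty using (⊥-elim)
open import Data.Nat using (zero; suc; s≤s)
open import Data.Fin using (Fin; toℕ; fromℕ<)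
open import Data.Fin.Properties using (all?; toℕ-fromℕ<)
open import Data.Integer using (-[1+_]; 0ℤ; 1ℤ; _+_; _-_; -_; _*_; _^_; _%ℕ_; _/ℕ_)
open import Data.Integer.DivMod using (a≡a%ℕn+[a/ℕn]*n; n%ℕd<d)
open import Data.Integer.Divisibility.Signed
  using (_∣_; divides; _∣?_; ∣ᵤ⇒∣; ∣m⇒∣-m; ∣m∣n⇒∣m+n; ∣n⇒∣m*n; ∣m⇒∣m*n; *-cancelʳ-∣)
open import Data.Integer.Properties
  using (pos-*; +-identityˡ; +-identityʳ; +-inverseʳ; *-zeroˡ; *-assoc; *-identityˡ; *-identityʳ)
open import Data.Integer.Tactic.RingSolver using (solve; solve-∀)
open import Data.List using (_∷_; [])
import Data.Nat.Divisibility as ℕᵈ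
open import Data.Product using (_,_)
open import Relation.Nullary.Decidable using (toWitness; ¬?)
open import Level using (0ℓ)
open import Relation.Binary.Bundles using (Setoid)
import Relation.Binary.Reasoning.Setoid as SetoidReasoning
open import Relation.Binary.PropositionalEquality
  using (refl; sym; trans; cong; subst; module ≡-Reasoning)

infix 4 _≡_mod_
record _≡_mod_ (a b n : ℤ) : Set where
  constructor from-∣
  field divides-difference : n ∣ a - b
open _≡_mod_ using (divides-difference)

module _ {n : ℤ} where

  mod-reflexive : ∀ {a b} → a ≡ b → a ≡ b mod n
  mod-reflexive {a} refl = from-∣ (divides 0ℤ (trans (+-inverseʳ a) (sym (*-zeroˡ n))))

  mod-refl : ∀ {a} → a ≡ a mod n
  mod-refl = mod-reflexive refl

  mod-sym : ∀ {a b} → a ≡ b mod n → b ≡ a mod n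
  mod-sym {a} {b} (from-∣ a≡b) = from-∣ (subst (n ∣_) (identity a b) (∣m⇒∣-m a≡b))
    where
    identity : ∀ a b → - (a - b) ≡ b - a
    identity = solve-∀

  mod-trans : ∀ {a b c} → a ≡ b mod n → b ≡ c mod n → a ≡ c mod n
  mod-trans {a} {b} {c} (from-∣ a≡b) (from-∣ b≡c) =
    from-∣ (subst (n ∣_) (identity a b c) (∣m∣n⇒∣m+n a≡b b≡c))
    where
    identity : ∀ a b c → (a - b) + (b - c) ≡ a - c
    identity = solve-∀

  +-cong-mod : ∀ {a b c d} → a ≡ b mod n → c ≡ d mod n → a + c ≡ b + d mod n
  +-cong-mod {a} {b} {c} {d} (from-∣ a≡b) (from-∣ c≡d) =
    from-∣ (subst (n ∣_) (identity a b c d) (∣m∣n⇒∣m+n a≡b c≡d))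
    where
    identity : ∀ a b c d → (a - b) + (c - d) ≡ (a + c) - (b + d)
    identity = solve-∀

  neg-cong-mod : ∀ {a b} → a ≡ b mod n → - a ≡ - b mod n
  neg-cong-mod {a} {b} (from-∣ a≡b) = from-∣ (subst (n ∣_) (identity a b) (∣m⇒∣-m a≡b))
    where
    identity : ∀ a b → - (a - b) ≡ - a - - b
    identity = solve-∀

  *-cong-mod : ∀ {a b c d} → a ≡ b mod n → c ≡ d mod n → a * c ≡ b * d mod n
  *-cong-mod {a} {b} {c} {d} (from-∣ a≡b) (from-∣ c≡d) =
    from-∣ (subst (n ∣_) (identity a b c d) (∣m∣n⇒∣m+n (∣n⇒∣m*n a c≡d) (∣m⇒∣m*n d a≡b)))
    where
    identity : ∀ a b c d → a * (c - d) + (a - b) * d ≡ a * c - b * d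
    identity = solve-∀

mod-setoid : ℤ → Setoid 0ℓ 0ℓ
mod-setoid n = record
  { Carrier       = ℤ
  ; _≈_           = λ a b → a ≡ b mod n
  ; isEquivalence = record { refl = mod-refl ; sym = mod-sym ; trans = mod-trans }
  }

i*i≡1⇒i^odd≡i : ∀ {n i} → i * i ≡ 1ℤ mod n → ∀ m → ¬ 2 ∣ℕ m → i ^ m ≡ i mod n
i*i≡1⇒i^odd≡i         i²≡1 zero          m-odd = ⊥-elim (m-odd (2 ℕᵈ.∣0))
i*i≡1⇒i^odd≡i {i = i} i²≡1 (suc zero)    m-odd = mod-reflexive (*-identityʳ i)
i*i≡1⇒i^odd≡i {n} {i} i²≡1 (suc (suc m)) m-odd = begin
  i * (i * i ^ m)  ≡⟨ *-assoc i i (i ^ m) ⟨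
  (i * i) * i ^ m  ≈⟨ *-cong-mod i²≡1 mod-refl ⟩
  1ℤ * i ^ m       ≡⟨ *-identityˡ (i ^ m) ⟩
  i ^ m            ≈⟨ i*i≡1⇒i^odd≡i i²≡1 m (λ 2∣m → m-odd (ℕᵈ.∣m∣n⇒∣m+n ℕᵈ.∣-refl 2∣m)) ⟩
  i                ∎
  where open SetoidReasoning (mod-setoid n)

pos-^ : ∀ m n → + (m ℕ.^ n) ≡ (+ m) ^ n
pos-^ m zero    = refl
pos-^ m (suc n) = trans (pos-* m (m ℕ.^ n)) (cong (+ m *_) (pos-^ m n))

[2*i]^n≡0[mod4] : ∀ i {n} → n ≥ 2 → (+ 2 * i) ^ n ≡ 0ℤ mod + 4
[2*i]^n≡0[mod4] i {suc (suc n)} (s≤s (s≤s _)) =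
  from-∣ (divides (i * i * (+ 2 * i) ^ n) (square i ((+ 2 * i) ^ n)))
  where
  square : ∀ i p → (+ 2 * i) * ((+ 2 * i) * p) - 0ℤ ≡ i * i * p * + 4
  square = solve-∀

2∣i⇒i*i≡i+i[mod4] : ∀ {i} → + 2 ∣ i → i * i ≡ i + i mod + 4
2∣i⇒i*i≡i+i[mod4] (divides j refl) = from-∣ (divides (j * j - j) (solve (j ∷ [])))

∣⇒%ℕ≡0 : ∀ i d .{{_ : ℕ.NonZero d}} → + d ∣ℤ i → i %ℕ d ≡ 0
∣⇒%ℕ≡0 (+ n)    d d∣n = ℕᵈ.n∣m⇒m%n≡0 n d d∣n
∣⇒%ℕ≡0 -[1+ n ] d d∣n with ℕ.suc n ℕ.% d | ℕᵈ.n∣m⇒m%n≡0 (ℕ.suc n) d d∣n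
... | zero | _ = refl

i/ℕd*d≡i : ∀ i d .{{_ : ℕ.NonZero d}} → + d ∣ℤ i → i /ℕ d * + d ≡ i
i/ℕd*d≡i i d d∣i = begin
  i /ℕ d * + d               ≡⟨ +-identityˡ _ ⟨
  + 0 + i /ℕ d * + d         ≡⟨ cong (λ r → + r + i /ℕ d * + d) (∣⇒%ℕ≡0 i d d∣i) ⟨
  + (i %ℕ d) + i /ℕ d * + d  ≡⟨ a≡a%ℕn+[a/ℕn]*n i d ⟨
  i                          ∎
  where open ≡-Reasoning

κ-even : ∀ t → + 8 ∣ℤ t - 1ℤ → + 2 ∣ κ t
κ-even t 8∣t-1 = *-cancelʳ-∣ (+ 4)
  (subst (+ 8 ∣_) (sym (i/ℕd*d≡i (t - 1ℤ) 4 (ℕᵈ.∣-trans (ℕᵈ.divides 2 refl) 8∣t-1)))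
    (∣ᵤ⇒∣ 8∣t-1))

-- A root k of X² − X − κ modulo N makes  m + nω ↦ m + nk  a ring homomorphism 𝒪 → ℤ/N.
module Reduction (t N k : ℤ) (k-root : k * k ≡ k + κ t mod N) where

  φ : 𝒪 → ℤ
  φ (m ⊕ n) = m + n * k

  φ-+ : ∀ u v → φ (_+𝒪_ t u v) ≡ φ u + φ v
  φ-+ (a ⊕ b) (c ⊕ d) = identity a b c d k
    where
    identity : ∀ a b c d k → (a + c) + (b + d) * k ≡ (a + b * k) + (c + d * k)
    identity = solve-∀

  φ-neg : ∀ u → φ (-𝒪_ t u) ≡ - φ u
  φ-neg (a ⊕ b) = identity a b k
    where
    identity : ∀ a b k → - a + - b * k ≡ - (a + b * k)
    identity = solve-∀

  φ-* : ∀ u v → φ (_*𝒪_ t u v) ≡ φ u * φ v mod N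
  φ-* (a ⊕ b) (c ⊕ d) =
    from-∣ (subst (N ∣_) (defect a b c d k (κ t)) (∣n⇒∣m*n (- (b * d)) (divides-difference k-root)))
    where
    defect : ∀ a b c d k κ → - (b * d) * (k * k - (k + κ)) ≡
      (a * c + b * d * κ) + (a * d + b * c + b * d) * k - (a + b * k) * (c + d * k)
    defect = solve-∀

  infix 4 _↦_
  record _↦_ (u : 𝒪) (U : ℤ) : Set where
    constructor reduces
    field φ≡ : φ u ≡ U mod N

  ↦-φ : ∀ u → u ↦ φ u
  ↦-φ u = reduces mod-refl

  ↦-ι : ∀ m → ι t m ↦ m
  ↦-ι m = reduces (mod-reflexive (+-identityʳ m))

  ↦-resp : ∀ {u U V} → u ↦ U → U ≡ V mod N → u ↦ V
  ↦-resp (reduces u≡U) U≡V = reduces (mod-trans u≡U U≡V)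

  ↦-+ : ∀ {u v U V} → u ↦ U → v ↦ V → _+𝒪_ t u v ↦ U + V
  ↦-+ {u} {v} (reduces u≡U) (reduces v≡V) =
    reduces (mod-trans (mod-reflexive (φ-+ u v)) (+-cong-mod u≡U v≡V))

  ↦-neg : ∀ {u U} → u ↦ U → -𝒪_ t u ↦ - U
  ↦-neg {u} (reduces u≡U) = reduces (mod-trans (mod-reflexive (φ-neg u)) (neg-cong-mod u≡U))

  ↦-- : ∀ {u v U V} → u ↦ U → v ↦ V → _-𝒪_ t u v ↦ U - V
  ↦-- u↦U v↦V = ↦-+ u↦U (↦-neg v↦V)

  ↦-* : ∀ {u v U V} → u ↦ U → v ↦ V → _*𝒪_ t u v ↦ U * V
  ↦-* {u} {v} (reduces u≡U) (reduces v≡V) = reduces (mod-trans (φ-* u v) (*-cong-mod u≡U v≡V))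

  ↦-^ : ∀ {u U} → u ↦ U → ∀ n → _^𝒪_ t u n ↦ U ^ n
  ↦-^ u↦U zero    = ↦-ι 1ℤ
  ↦-^ u↦U (suc n) = ↦-* u↦U (↦-^ u↦U n)

reducedForm : ℤ → ℤ → ℤ → ℤ
reducedForm y z w = + 3 - y * y - z * z + + 2 * w * y * z

reducedForm-cong : ∀ {n y y′ z z′ w w′} →
  y ≡ y′ mod n → z ≡ z′ mod n → w ≡ w′ mod n →
  reducedForm y z w ≡ reducedForm y′ z′ w′ mod n
reducedForm-cong y≡ z≡ w≡ =
  +-cong-mod (+-cong-mod (+-cong-mod (mod-refl {a = + 3}) (neg-cong-mod (*-cong-mod y≡ y≡)))
                         (neg-cong-mod (*-cong-mod z≡ z≡)))
             (*-cong-mod (*-cong-mod (*-cong-mod (mod-refl {a = + 2}) w≡) y≡) z≡)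

residue : ∀ i d .{{_ : ℕ.NonZero d}} → Σ (Fin d) λ r → i ≡ + toℕ r mod + d
residue i d = fromℕ< (n%ℕd<d i d) , from-∣ (divides (i /ℕ d) i-r≡q*d)
  where
  i-r≡q*d : i - + toℕ (fromℕ< (n%ℕd<d i d)) ≡ i /ℕ d * + d
  i-r≡q*d rewrite toℕ-fromℕ< (n%ℕd<d i d) =
    trans (cong (_- + (i %ℕ d)) (a≡a%ℕn+[a/ℕn]*n i d)) (cancel (+ (i %ℕ d)) (i /ℕ d * + d))
    where
    cancel : ∀ r q → r + q - r ≡ q
    cancel = solve-∀

reducedForm≢0[mod4] : ∀ y z w → ¬ (reducedForm y z w ≡ 0ℤ mod + 4)
reducedForm≢0[mod4] y z w rf≡0
  with residue y 4 | residue z 4 | residue w 4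
... | y₀ , y≡y₀ | z₀ , z≡z₀ | w₀ , w≡w₀ =
  on-residues y₀ z₀ w₀
    (divides-difference (mod-trans (mod-sym (reducedForm-cong y≡y₀ z≡z₀ w≡w₀)) rf≡0))
  where
  on-residues : ∀ (y z w : Fin 4) → ¬ (+ 4 ∣ reducedForm (+ toℕ y) (+ toℕ z) (+ toℕ w) - 0ℤ)
  on-residues = toWitness {a? = all? λ y → all? λ z → all? λ w → ¬? (+ 4 ∣? _)} _

equation : (t : ℤ) (a b : 𝒪) (d r : ℕ) (x y z : 𝒪) → 𝒪
equation t a b d r x y z =
  _-𝒪_ t (_+𝒪_ t (_-𝒪_ t (_-𝒪_ t (_*𝒪_ t a (_^𝒪_ t x d)) (_*𝒪_ t y y)) (_*𝒪_ t z z)) (_*𝒪_ t (_*𝒪_ t x y) z))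
         (_-𝒪_ t (_*𝒪_ t (ι t (+ (2 ℕ.^ d))) b) (ι t (+ (3 ℕ.^ r))))

module ReductionMod4 (t : ℤ) (8∣t-1 : + 8 ∣ℤ t - 1ℤ) where
  open Reduction t (+ 4) (κ t) (2∣i⇒i*i≡i+i[mod4] (κ-even t 8∣t-1)) public

  equation↦reducedForm : ∀ a b {d} r w y z → d ≥ 2 → ¬ 2 ∣ℕ r →
    equation t a b d r (_*𝒪_ t (ι t (+ 2)) w) y z ↦ reducedForm (φ y) (φ z) (φ w)
  equation↦reducedForm a b {d} r w y z d≥2 r-odd =
    ↦-resp (↦-- (↦-+ (↦-- (↦-- (↦-* (↦-φ a) xᵈ↦0) (↦-* (↦-φ y) (↦-φ y))) (↦-* (↦-φ z) (↦-φ z)))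
                     (↦-* (↦-* x↦2w (↦-φ y)) (↦-φ z)))
                (↦-- (↦-* 2ᵈ↦0 (↦-φ b)) 3ʳ↦3))
           (mod-reflexive (simplify (φ a) (φ b) (φ w) (φ y) (φ z)))
    where
    x↦2w : _*𝒪_ t (ι t (+ 2)) w ↦ + 2 * φ w
    x↦2w = ↦-* (↦-ι (+ 2)) (↦-φ w)

    xᵈ↦0 : _^𝒪_ t (_*𝒪_ t (ι t (+ 2)) w) d ↦ 0ℤ
    xᵈ↦0 = ↦-resp (↦-^ x↦2w d) ([2*i]^n≡0[mod4] (φ w) d≥2)

    2ᵈ↦0 : ι t (+ (2 ℕ.^ d)) ↦ 0ℤ
    2ᵈ↦0 = ↦-resp (↦-ι _) (mod-trans (mod-reflexive (pos-^ 2 d)) ([2*i]^n≡0[mod4] 1ℤ d≥2))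

    3ʳ↦3 : ι t (+ (3 ℕ.^ r)) ↦ + 3
    3ʳ↦3 = ↦-resp (↦-ι _)
      (mod-trans (mod-reflexive (pos-^ 3 r)) (i*i≡1⇒i^odd≡i (from-∣ (divides (+ 2) refl)) r r-odd))

    simplify : ∀ A B W Y Z →
      A * 0ℤ - Y * Y - Z * Z + (+ 2 * W) * Y * Z - (0ℤ * B - + 3) ≡
      + 3 - Y * Y - Z * Z + + 2 * W * Y * Z
    simplify = solve-∀

corollary2p3 : (t : ℤ) → SquareFree t → t ≢ ℤ.1ℤ → (+ 8) ∣ℤ (t ℤ.- ℤ.1ℤ) →
    (a b : 𝒪) → a ≢ 0𝒪 t → b ≢ 0𝒪 t →
    (r d : ℕ) → r ≥ 1 → d ≥ 2 → ¬ (2 ∣ℕ r) →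
    ¬ (Σ 𝒪 λ x → Σ 𝒪 λ y → Σ 𝒪 λ z → (Σ 𝒪 λ w → x ≡ _*𝒪_ t (ι t (+ 2)) w) ×
        (_-𝒪_ t (_+𝒪_ t (_-𝒪_ t (_-𝒪_ t (_*𝒪_ t a (_^𝒪_ t x d)) (_*𝒪_ t y y)) (_*𝒪_ t z z)) (_*𝒪_ t (_*𝒪_ t x y) z))
           (_-𝒪_ t (_*𝒪_ t (ι t (+ (2 ℕ.^ d))) b) (ι t (+ (3 ℕ.^ r))))
         ≡ 0𝒪 t))
corollary2p3 t _ _ 8∣t-1 a b _ _ r d _ d≥2 r-odd (_ , y , z , (w , refl) , solution) =
  reducedForm≢0[mod4] (φ y) (φ z) (φ w) (mod-sym (_↦_.φ≡ 0↦reducedForm))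
  where
  open ReductionMod4 t 8∣t-1
  0↦reducedForm : 0𝒪 t ↦ reducedForm (φ y) (φ z) (φ w)
  0↦reducedForm = subst (_↦ reducedForm (φ y) (φ z) (φ w)) solution
    (equation↦reducedForm a b r w y z d≥2 r-odd)
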